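{- Let $\ell \geqslant 0$ be an integer. An $\ell$-finite graph $G$ is $\ell$-minimal if and only if $G = G[\ell]$.
   Context: All graphs are undirected and loopless; they may contain parallel edges and may be infinite. For $\ell \geqslant 0$, an $\ell$-link of $G$ is a walk of length $\ell$ in which consecutive edges are different, identified with its reverse. The $\ell$-link graph $\mathbb{L}_\ell(G)$ has as vertices the $\ell$-links of $G$, and for every $(\ell+1)$-link $[v_0, e_1, \ldots, e_{\ell+1}, v_{\ell+1}]$ one edge joining $[v_0, \ldots, e_\ell, v_\ell]$ and $[v_1, \ldots, e_{\ell+1}, v_{\ell+1}]$. $G$ is $\ell$-finite if $\mathbb{L}_\ell(G)$ is finite. An $\ell$-finite graph $X$ is $\ell$-minimal if $X$ is null or for every graph $Y$ isomorphic to a proper subgraph of $X$, $\mathbb{L}_\ell(Y)$ is isomorphic to a proper subgraph of $\mathbb{L}_\ell(X)$. A unit is a vertex or an edge; two links are incident if one is a subsequence (consecutive subwalk, up to reversal) of the other; a unit is $\ell$-incident in $G$ if it is incident to some $\ell$-link of $G$. $G[\ell]$ is the subgraph of $G$ whose vertices and edges are the $\ell$-incident vertices and edges of $G$. -}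

module Defs where

open import Level using (0ℓ)
open import Data.Nat using (ℕ; zero; suc; _+_; _≤_)
open import Data.Fin using (Fin; zero; suc; toℕ; inject₁; opposite)
open import Data.Fin.Properties using (toℕ-inject₁)
open import Data.Product using (Σ; Σ-syntax; ∃; ∃-syntax; _×_; _,_)
open import Data.Sum using (_⊎_; inj₁; inj₂)
open import Data.Empty using (⊥)
open import Relation.Nullary using (¬_)
open import Relation.Binary.PropositionalEquality
  using (_≡_; _≢_; refl; sym; trans; cong; subst)

-- Graphs (undirected multigraphs, possibly infinite).
-- An edge e has two ends end₁ e, end₂ e; the orientation is irrelevant:
-- everything below only uses the symmetric relation Joins.

record Graph : Set₁ where
  field
    V E  : Set
    end₁ : E → V
    end₂ : E → V

open Graph public

Loopless : Graph → Set
Loopless G = ∀ e → end₁ G e ≢ end₂ G e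

Null : Graph → Set
Null G = V G → ⊥

Joins : (G : Graph) → E G → V G → V G → Set
Joins G e u v = (end₁ G e ≡ u × end₂ G e ≡ v) ⊎ (end₁ G e ≡ v × end₂ G e ≡ u)

-- Graphs presented on setoids (needed because ℓ-links are walks
-- identified with their reverse).  The relations _≈V_ / _≈E_ play the
-- role of equality of vertices / edges.

record SGraph : Set₁ where
  field
    SV SE : Set
    _≈V_  : SV → SV → Set
    _≈E_  : SE → SE → Set
    send₁ : SE → SV
    send₂ : SE → SV

open SGraph public

SJoins : (A : SGraph) → SE A → SV A → SV A → Set
SJoins A e u v =
  (_≈V_ A (send₁ A e) u × _≈V_ A (send₂ A e) v)
  ⊎ (_≈V_ A (send₁ A e) v × _≈V_ A (send₂ A e) u)

toS : Graph → SGraph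
toS G = record { SV = V G ; SE = E G ; _≈V_ = _≡_ ; _≈E_ = _≡_
               ; send₁ = end₁ G ; send₂ = end₂ G }

record _≅_ (A B : SGraph) : Set where
  field
    fV      : SV A → SV B
    fE      : SE A → SE B
    fV-cong : ∀ {x y} → _≈V_ A x y → _≈V_ B (fV x) (fV y)
    fE-cong : ∀ {x y} → _≈E_ A x y → _≈E_ B (fE x) (fE y)
    fV-inj  : ∀ {x y} → _≈V_ B (fV x) (fV y) → _≈V_ A x y
    fE-inj  : ∀ {x y} → _≈E_ B (fE x) (fE y) → _≈E_ A x y
    fV-surj : ∀ y → Σ (SV A) λ x → _≈V_ B (fV x) y
    fE-surj : ∀ y → Σ (SE A) λ x → _≈E_ B (fE x) y
    incid   : ∀ e → SJoins B (fE e) (fV (send₁ A e)) (fV (send₂ A e))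

record Sub (A : SGraph) : Set₁ where
  field
    inV    : SV A → Set
    inE    : SE A → Set
    respV  : ∀ {x y} → _≈V_ A x y → inV x → inV y
    respE  : ∀ {x y} → _≈E_ A x y → inE x → inE y
    closed : ∀ e → inE e → inV (send₁ A e) × inV (send₂ A e)

open Sub public

SubG : {A : SGraph} → Sub A → SGraph
SubG {A} S = record
  { SV = Σ (SV A) (inV S)
  ; SE = Σ (SE A) (inE S)
  ; _≈V_ = λ x y → _≈V_ A (Σ.proj₁ x) (Σ.proj₁ y)
  ; _≈E_ = λ x y → _≈E_ A (Σ.proj₁ x) (Σ.proj₁ y)
  ; send₁ = λ e → send₁ A (Σ.proj₁ e) , Σ.proj₁ (closed S (Σ.proj₁ e) (Σ.proj₂ e))
  ; send₂ = λ e → send₂ A (Σ.proj₁ e) , Σ.proj₂ (closed S (Σ.proj₁ e) (Σ.proj₂ e))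
  }

Proper : {A : SGraph} → Sub A → Set
Proper {A} S = (Σ (SV A) λ v → ¬ inV S v) ⊎ (Σ (SE A) λ e → ¬ inE S e)

FiniteBy : (X : Set) → (X → X → Set) → Set
FiniteBy X _≈_ = Σ ℕ λ n → Σ (Fin n → X) λ f → ∀ x → Σ (Fin n) λ i → f i ≈ x

FiniteS : SGraph → Set
FiniteS A = FiniteBy (SV A) (_≈V_ A) × FiniteBy (SE A) (_≈E_ A)

-- Walks without backtracking (oriented ℓ-links)

record Walk (G : Graph) (n : ℕ) : Set where
  field
    vs    : Fin (suc n) → V G
    es    : Fin n → E G
    joins : ∀ (i : Fin n) → Joins G (es i) (vs (inject₁ i)) (vs (suc i))
    nobt  : ∀ (i j : Fin n) → toℕ j ≡ suc (toℕ i) → es i ≢ es j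

open Walk public

SameLink : {G : Graph} {n : ℕ} → Walk G n → Walk G n → Set
SameLink W W' =
  ((∀ i → vs W i ≡ vs W' i) × (∀ i → es W i ≡ es W' i))
  ⊎ ((∀ i → vs W i ≡ vs W' (opposite i)) × (∀ i → es W i ≡ es W' (opposite i)))

initW : {G : Graph} {n : ℕ} → Walk G (suc n) → Walk G n
initW {G} {n} W = record
  { vs = λ i → vs W (inject₁ i)
  ; es = λ i → es W (inject₁ i)
  ; joins = λ i → joins W (inject₁ i)
  ; nobt = λ i j p → nobt W (inject₁ i) (inject₁ j)
      (trans (toℕ-inject₁ j) (trans p (cong suc (sym (toℕ-inject₁ i)))))
  }

tailW : {G : Graph} {n : ℕ} → Walk G (suc n) → Walk G n
tailW W = record
  { vs = λ i → vs W (suc i)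
  ; es = λ i → es W (suc i)
  ; joins = λ i → joins W (suc i)
  ; nobt = λ i j p → nobt W (suc i) (suc j) (cong suc p)
  }

𝕃 : ℕ → Graph → SGraph
𝕃 ℓ G = record
  { SV = Walk G ℓ
  ; SE = Walk G (suc ℓ)
  ; _≈V_ = SameLink
  ; _≈E_ = SameLink
  ; send₁ = initW
  ; send₂ = tailW
  }

Finite : ℕ → Graph → Set
Finite ℓ G = FiniteS (𝕃 ℓ G)

Minimal : ℕ → Graph → Set₁
Minimal ℓ X =
  Null X ⊎
  (∀ (Y : Graph) → Loopless Y →
     (Σ (Sub (toS X)) λ S → Proper S × (toS Y ≅ SubG S)) →
     Σ (Sub (𝕃 ℓ X)) λ T → Proper T × (𝕃 ℓ Y ≅ SubG T))

SubWalkAt : {G : Graph} {m n : ℕ} → ℕ → Walk G m → Walk G n → Set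
SubWalkAt {m = m} {n} k W' W =
  k + m ≤ n
  × (∀ (i : Fin (suc m)) (j : Fin (suc n)) → toℕ j ≡ k + toℕ i → vs W' i ≡ vs W j)
  × (∀ (i : Fin m) (j : Fin n) → toℕ j ≡ k + toℕ i → es W' i ≡ es W j)

RevSubWalkAt : {G : Graph} {m n : ℕ} → ℕ → Walk G m → Walk G n → Set
RevSubWalkAt {m = m} {n} k W' W =
  k + m ≤ n
  × (∀ (i : Fin (suc m)) (j : Fin (suc n)) → toℕ j ≡ k + toℕ i → vs W' (opposite i) ≡ vs W j)
  × (∀ (i : Fin m) (j : Fin n) → toℕ j ≡ k + toℕ i → es W' (opposite i) ≡ es W j)

SubLink : {G : Graph} {m n : ℕ} → Walk G m → Walk G n → Set
SubLink W' W = Σ ℕ λ k → SubWalkAt k W' W ⊎ RevSubWalkAt k W' W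

Incident : {G : Graph} {m n : ℕ} → Walk G m → Walk G n → Set
Incident A B = SubLink A B ⊎ SubLink B A

vertexLink : {G : Graph} → V G → Walk G 0
vertexLink v = record { vs = λ _ → v ; es = λ () ; joins = λ () ; nobt = λ () }

edgeLink : {G : Graph} → E G → Walk G 1
edgeLink {G} e = record
  { vs = λ { zero → end₁ G e ; (suc zero) → end₂ G e }
  ; es = λ _ → e
  ; joins = λ { zero → inj₁ (refl , refl) }
  ; nobt = λ { zero zero () }
  }

VIncident : (ℓ : ℕ) (G : Graph) → V G → Set
VIncident ℓ G v = Σ (Walk G ℓ) λ W → Incident (vertexLink v) W

EIncident : (ℓ : ℕ) (G : Graph) → E G → Set
EIncident ℓ G e = Σ (Walk G ℓ) λ W → Incident (edgeLink e) W

record UnitSets (G : Graph) : Set₁ where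
  field
    vset : V G → Set
    eset : E G → Set

_[_] : (G : Graph) → ℕ → UnitSets G
G [ ℓ ] = record { vset = VIncident ℓ G ; eset = EIncident ℓ G }

-- "G = G[ℓ]": G[ℓ] contains every vertex and every edge of G
IsWhole : {G : Graph} → UnitSets G → Set
IsWhole {G} U = (∀ v → UnitSets.vset U v) × (∀ e → UnitSets.eset U e)

module Submission where

-- (⇐) Suppose every unit of G is ℓ-incident, and let Y be isomorphic to a
-- proper subgraph S of G.  Transporting links along Y ≅ S embeds 𝕃ℓ(Y) into
-- 𝕃ℓ(G); its image is a subgraph all of whose links avoid the units missing
-- from S.  A missing unit lies on some ℓ-link of G (for an edge and ℓ = 0:
-- on the 1-link formed by the edge), which is therefore missing from the image.
--
-- (⇒) Classically decide which units are ℓ-incident and let Y be the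
-- resulting subgraph G[ℓ].  Every ℓ-link and (ℓ+1)-link of G lies in Y, so
-- 𝕃ℓ(G) injects into 𝕃ℓ(Y).  If G[ℓ] were proper, minimality would make
-- 𝕃ℓ(Y) isomorphic to a proper subgraph of the finite graph 𝕃ℓ(G), giving
-- an injection of a finite setoid into a proper part of itself.

open import Defs
open import Level using (0ℓ)
open import Function using (_∘_)
open import Data.Nat using (ℕ; zero; suc; _+_; _≤_; _<_; z≤n; s≤s)
open import Data.Nat.Properties using (n≮n; +-identityʳ; +-comm; m+n≤o⇒m≤o; m+n≤o⇒n≤o; m<m+n; <-≤-trans)
open import Data.Fin using (Fin; zero; suc; punchIn; punchOut; _≟_; toℕ; inject₁; opposite; fromℕ<)
open import Data.Fin.Properties using (punchOut-injective; punchIn-punchOut; injective⇒≤; toℕ-injective; toℕ-inject₁; toℕ-fromℕ<; toℕ<n; toℕ≤pred[n]; opposite-involutive)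
open import Data.Product using (Σ; _,_; proj₁; proj₂; _×_)
open import Data.Sum using (_⊎_; inj₁; inj₂; swap)
open import Data.Bool using (Bool; T)
open import Data.Bool.Properties using (T-irrelevant)
open import Data.Empty using (⊥-elim)
open import Relation.Nullary using (¬_; yes; no)
open import Relation.Nullary.Decidable using (isYes; toWitness; fromWitness; decidable-stable)
open import Relation.Binary.Bundles using (Setoid)
open import Relation.Binary.PropositionalEquality using (_≡_; _≢_; refl; sym; trans; cong; subst)
open import Axiom.ExcludedMiddle using (ExcludedMiddle)

fin-injective-selfmap-onto : ∀ {n} (h : Fin n → Fin n) → (∀ {i j} → h i ≡ h j → i ≡ j) →
                             (k : Fin n) → ¬ (∀ i → k ≢ h i)
fin-injective-selfmap-onto {suc m} h h-inj k missed = n≮n m (injective⇒≤ squeezed-inj)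
  where
  -- removing the missed index k squeezes h into Fin m
  squeezed : Fin (suc m) → Fin m
  squeezed i = punchOut (missed i)
  squeezed-inj : ∀ {i j} → squeezed i ≡ squeezed j → i ≡ j
  squeezed-inj {i} {j} eq = h-inj (punchOut-injective (missed i) (missed j) eq)

-- Finite setoids (finitely enumerable up to ≈) are Dedekind finite, classically.
module FiniteSetoid (em : ExcludedMiddle 0ℓ) (X : Setoid 0ℓ 0ℓ) where
  open Setoid X using (_≈_; reflexive) renaming (Carrier to A; sym to ≈-sym; trans to ≈-trans)

  record Listing : Set where
    field
      size : ℕ
      item : Fin size → A
      onto : ∀ x → Σ (Fin size) λ i → item i ≈ x
      once : ∀ {i j} → item i ≈ item j → i ≡ j

  removeRepetitions : ∀ n (f : Fin n → A) → (∀ x → Σ (Fin n) λ i → f i ≈ x) → Listing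
  removeRepetitions n f onto with em {Σ (Fin n) λ i → Σ (Fin n) λ j → i ≢ j × f i ≈ f j}
  ... | no noRepeat = record { size = n ; item = f ; onto = onto ; once = once }
    where
    once : ∀ {i j} → f i ≈ f j → i ≡ j
    once {i} {j} fi≈fj with i ≟ j
    ... | yes i≡j = i≡j
    ... | no i≢j = ⊥-elim (noRepeat (i , j , i≢j , fi≈fj))
  removeRepetitions zero f onto | yes (() , _)
  removeRepetitions (suc n) f onto | yes (i , j , i≢j , fi≈fj) =
    removeRepetitions n (f ∘ punchIn j) onto′
    where
    -- f ∘ punchIn j omits exactly the index j, whose value f i still represents
    kept : ∀ {k} → j ≢ k → Σ (Fin n) λ k′ → f (punchIn j k′) ≈ f k
    kept j≢k = punchOut j≢k , reflexive (cong f (punchIn-punchOut j≢k))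
    onto′ : ∀ x → Σ (Fin n) λ k → f (punchIn j k) ≈ x
    onto′ x with onto x
    ... | k , fk≈x with j ≟ k
    ... | yes refl = let (k′ , same) = kept (λ j≡i → i≢j (sym j≡i)) in k′ , ≈-trans (≈-trans same fi≈fj) fk≈x
    ... | no j≢k = let (k′ , same) = kept j≢k in k′ , ≈-trans same fk≈x

  -- a listing turns an injective self-map of A missing y into one of Fin size
  listed-injective-selfmap-onto : Listing → (g : A → A) → (∀ {x y} → g x ≈ g y → x ≈ y) →
                                  (y : A) → ¬ (∀ x → ¬ g x ≈ y)
  listed-injective-selfmap-onto L g g-inj y missed = fin-injective-selfmap-onto h h-inj k k-missed
    where
    open Listing L
    h : Fin size → Fin size
    h i = proj₁ (onto (g (item i)))
    h-spec : ∀ i → item (h i) ≈ g (item i)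
    h-spec i = proj₂ (onto (g (item i)))
    h-inj : ∀ {i j} → h i ≡ h j → i ≡ j
    h-inj {i} {j} hi≡hj =
      once (g-inj (≈-trans (≈-sym (h-spec i)) (≈-trans (reflexive (cong item hi≡hj)) (h-spec j))))
    k : Fin size
    k = proj₁ (onto y)
    k-missed : ∀ i → k ≢ h i
    k-missed i k≡hi =
      missed (item i) (≈-trans (≈-sym (h-spec i)) (≈-trans (reflexive (cong item (sym k≡hi))) (proj₂ (onto y))))

  no-injection-into-proper-part : FiniteBy A _≈_ → (P : A → Set) → (∀ {x y} → x ≈ y → P x → P y) →
                                  (w : A) → ¬ P w → (g : A → A) → (∀ {x y} → g x ≈ g y → x ≈ y) →
                                  ¬ (∀ x → P (g x))
  no-injection-into-proper-part (n , f , onto) P P-resp w w∉P g g-inj g∈P =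
    listed-injective-selfmap-onto (removeRepetitions n f onto) g g-inj w
      (λ x gx≈w → w∉P (P-resp gx≈w (g∈P x)))

module _ {A : Set} {m : ℕ} where
  flip-opposite : {f g : Fin m → A} → (∀ i → f i ≡ g (opposite i)) → ∀ i → g i ≡ f (opposite i)
  flip-opposite {f} {g} f≡g∘opp i = sym (trans (f≡g∘opp (opposite i)) (cong g (opposite-involutive i)))

  cancel-opposite : {f g h : Fin m → A} → (∀ i → f i ≡ g (opposite i)) → (∀ i → g i ≡ h (opposite i)) →
                    ∀ i → f i ≡ h i
  cancel-opposite {h = h} p q i = trans (p i) (trans (q (opposite i)) (cong h (opposite-involutive i)))

linkSetoid : Graph → ℕ → Setoid 0ℓ 0ℓ
linkSetoid G n = record
  { Carrier = Walk G n
  ; _≈_ = SameLink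
  ; isEquivalence = record
    { refl = λ {W} → same-refl {W}
    ; sym = λ {W} {X} → same-sym {W} {X}
    ; trans = λ {W} {X} {Z} → same-trans {W} {X} {Z}
    }
  }
  where
  same-refl : {W : Walk G n} → SameLink W W
  same-refl = inj₁ ((λ _ → refl) , (λ _ → refl))
  same-sym : {W X : Walk G n} → SameLink W X → SameLink X W
  same-sym (inj₁ (p , q)) = inj₁ ((λ i → sym (p i)) , (λ i → sym (q i)))
  same-sym (inj₂ (p , q)) = inj₂ (flip-opposite p , flip-opposite q)
  same-trans : {W X Z : Walk G n} → SameLink W X → SameLink X Z → SameLink W Z
  same-trans (inj₁ (p , q)) (inj₁ (r , s)) = inj₁ ((λ i → trans (p i) (r i)) , (λ i → trans (q i) (s i)))
  same-trans (inj₁ (p , q)) (inj₂ (r , s)) = inj₂ ((λ i → trans (p i) (r i)) , (λ i → trans (q i) (s i)))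
  same-trans (inj₂ (p , q)) (inj₁ (r , s)) =
    inj₂ ((λ i → trans (p i) (r (opposite i))) , (λ i → trans (q i) (s (opposite i))))
  same-trans (inj₂ (p , q)) (inj₂ (r , s)) = inj₁ (cancel-opposite p r , cancel-opposite q s)

opposite-inject₁ : ∀ {n} (i : Fin n) → opposite (inject₁ i) ≡ suc (opposite i)
opposite-inject₁ {suc m} zero = refl
opposite-inject₁ {suc m} (suc i) = cong inject₁ (opposite-inject₁ i)

SameLink-ends : {G : Graph} {n : ℕ} {W X : Walk G (suc n)} → SameLink W X →
  (SameLink (initW W) (initW X) × SameLink (tailW W) (tailW X))
  ⊎ (SameLink (initW W) (tailW X) × SameLink (tailW W) (initW X))
SameLink-ends (inj₁ (p , q)) =
  inj₁ (inj₁ ((p ∘ inject₁) , (q ∘ inject₁)) , inj₁ ((p ∘ suc) , (q ∘ suc)))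
SameLink-ends {W = W} {X} (inj₂ (p , q)) =
  inj₂ (inj₂ ((λ i → subst (λ t → vs W (inject₁ i) ≡ vs X t) (opposite-inject₁ i) (p (inject₁ i)))
             , (λ i → subst (λ t → es W (inject₁ i) ≡ es X t) (opposite-inject₁ i) (q (inject₁ i))))
       , inj₂ ((p ∘ suc) , (q ∘ suc)))

index-at : ∀ {m} (i j : Fin m) → toℕ j ≡ toℕ i + 0 → j ≡ i
index-at i j at = toℕ-injective (trans at (+-identityʳ (toℕ i)))

index-at-inject₁ : ∀ {m} (i : Fin m) (j : Fin (suc m)) → toℕ j ≡ toℕ i + 0 → j ≡ inject₁ i
index-at-inject₁ i j at = toℕ-injective (trans at (trans (+-identityʳ (toℕ i)) (sym (toℕ-inject₁ i))))

index-after : ∀ {m} (i : Fin m) (j : Fin (suc m)) → toℕ j ≡ toℕ i + 1 → j ≡ suc i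
index-after i j at = toℕ-injective (trans at (+-comm (toℕ i) 1))

index-from : ∀ k {n} → k < n → Σ (Fin n) λ j → toℕ j ≡ k + 0
index-from k k<n = fromℕ< k<n , trans (toℕ-fromℕ< k<n) (sym (+-identityʳ k))

module _ {G : Graph} where
  vertex-incident : ∀ {n} (W : Walk G n) (i : Fin (suc n)) → Incident (vertexLink (vs W i)) W
  vertex-incident {n} W i = inj₁ (toℕ i , inj₁ (fits , same-vertex , λ ()))
    where
    fits : toℕ i + 0 ≤ n
    fits = subst (_≤ n) (sym (+-identityʳ (toℕ i))) (toℕ≤pred[n] i)
    same-vertex : ∀ (p : Fin 1) j → toℕ j ≡ toℕ i + toℕ p → vs W i ≡ vs W j
    same-vertex zero j at = cong (vs W) (sym (index-at i j at))

  edge-incident : ∀ {n} (W : Walk G n) (i : Fin n) → Incident (edgeLink (es W i)) W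
  edge-incident {n} W i = inj₁ (toℕ i , oriented (joins W i))
    where
    fits : toℕ i + 1 ≤ n
    fits = subst (_≤ n) (+-comm 1 (toℕ i)) (toℕ<n i)
    same-edge : ∀ (p : Fin 1) j → toℕ j ≡ toℕ i + toℕ p → es W i ≡ es W j
    same-edge zero j at = cong (es W) (sym (index-at i j at))
    before : ∀ j → toℕ j ≡ toℕ i + 0 → vs W (inject₁ i) ≡ vs W j
    before j at = cong (vs W) (sym (index-at-inject₁ i j at))
    after : ∀ j → toℕ j ≡ toℕ i + 1 → vs W (suc i) ≡ vs W j
    after j at = cong (vs W) (sym (index-after i j at))
    oriented : Joins G (es W i) (vs W (inject₁ i)) (vs W (suc i)) →
               SubWalkAt (toℕ i) (edgeLink (es W i)) W ⊎ RevSubWalkAt (toℕ i) (edgeLink (es W i)) W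
    oriented (inj₁ (end₁≡ , end₂≡)) = inj₁ (fits , ends , same-edge)
      where
      ends : ∀ (p : Fin 2) j → toℕ j ≡ toℕ i + toℕ p → vs (edgeLink {G} (es W i)) p ≡ vs W j
      ends zero j at = trans end₁≡ (before j at)
      ends (suc zero) j at = trans end₂≡ (after j at)
    oriented (inj₂ (end₁≡ , end₂≡)) = inj₂ (fits , ends , same-edge)
      where
      ends : ∀ (p : Fin 2) j → toℕ j ≡ toℕ i + toℕ p → vs (edgeLink {G} (es W i)) (opposite p) ≡ vs W j
      ends zero j at = trans end₂≡ (before j at)
      ends (suc zero) j at = trans end₁≡ (after j at)

  vertex-occurs : ∀ {n v} {W : Walk G n} → Incident (vertexLink v) W → Σ (Fin (suc n)) λ i → vs W i ≡ v
  vertex-occurs (inj₁ (k , inj₁ (fits , same , _))) =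
    let (j , at) = index-from k (s≤s (m+n≤o⇒m≤o k fits)) in j , sym (same zero j at)
  vertex-occurs (inj₁ (k , inj₂ (fits , same , _))) =
    let (j , at) = index-from k (s≤s (m+n≤o⇒m≤o k fits)) in j , sym (same zero j at)
  vertex-occurs (inj₂ (zero , inj₁ (_ , same , _))) = zero , same zero zero refl
  vertex-occurs (inj₂ (zero , inj₂ (_ , same , _))) = opposite zero , same zero zero refl
  vertex-occurs (inj₂ (suc k , inj₁ (() , _)))
  vertex-occurs (inj₂ (suc k , inj₂ (() , _)))

  edge-occurs : ∀ {n e} {W : Walk G (suc n)} → Incident (edgeLink e) W → Σ (Fin (suc n)) λ i → es W i ≡ e
  edge-occurs (inj₁ (k , inj₁ (fits , _ , same))) =
    let (j , at) = index-from k (<-≤-trans (m<m+n k (s≤s z≤n)) fits) in j , sym (same zero j at)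
  edge-occurs (inj₁ (k , inj₂ (fits , _ , same))) =
    let (j , at) = index-from k (<-≤-trans (m<m+n k (s≤s z≤n)) fits) in j , sym (same zero j at)
  edge-occurs (inj₂ (zero , inj₁ (_ , _ , same))) = zero , same zero zero refl
  edge-occurs (inj₂ (zero , inj₂ (_ , _ , same))) = opposite zero , same zero zero refl
  edge-occurs (inj₂ (suc k , inj₁ (s≤s fits , _))) with m+n≤o⇒n≤o k fits
  ... | ()
  edge-occurs (inj₂ (suc k , inj₂ (s≤s fits , _))) with m+n≤o⇒n≤o k fits
  ... | ()

  -- each unit of an (ℓ+1)-link lies on one of its end ℓ-links, hence is ℓ-incident
  vertex-of-longer-link : ∀ ℓ (W : Walk G (suc ℓ)) i → VIncident ℓ G (vs W i)
  vertex-of-longer-link ℓ W zero = initW W , vertex-incident (initW W) zero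
  vertex-of-longer-link ℓ W (suc i) = tailW W , vertex-incident (tailW W) i

  -- for ℓ = 0 an edge of a 1-link contains the 0-link at its first end
  edge-of-longer-link : ∀ ℓ (W : Walk G (suc ℓ)) i → EIncident ℓ G (es W i)
  edge-of-longer-link zero W zero = vertexLink (end₁ G e) , inj₂ (0 , inj₁ (z≤n , at-start , λ ()))
    where
    e = es W zero
    at-start : ∀ (p : Fin 1) (j : Fin 2) → toℕ j ≡ toℕ p → end₁ G e ≡ vs (edgeLink {G} e) j
    at-start zero zero _ = refl
    at-start zero (suc _) ()
  edge-of-longer-link (suc ℓ) W zero = initW W , edge-incident (initW W) zero
  edge-of-longer-link (suc ℓ) W (suc i) = tailW W , edge-incident (tailW W) i

-- An isomorphism Y ≅ S onto a subgraph S of G carries links of Y to links of G;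
-- this embeds 𝕃ℓ(Y) as a subgraph of 𝕃ℓ(G) whose links use only units of S.
module Embedding {G Y : Graph} {S : Sub (toS G)} (φ : toS Y ≅ SubG S) where
  open _≅_ φ

  vertexOf : V Y → V G
  vertexOf = proj₁ ∘ fV

  edgeOf : E Y → E G
  edgeOf = proj₁ ∘ fE

  embed-joins : ∀ {e a b} → Joins Y e a b → Joins G (edgeOf e) (vertexOf a) (vertexOf b)
  embed-joins {e} (inj₁ (refl , refl)) = incid e
  embed-joins {e} (inj₂ (refl , refl)) = swap (incid e)

  embed : ∀ {n} → Walk Y n → Walk G n
  embed W = record
    { vs = vertexOf ∘ vs W
    ; es = edgeOf ∘ es W
    ; joins = λ i → embed-joins (joins W i)
    ; nobt = λ i j next same → nobt W i j next (fE-inj same)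
    }

  embed-cong : ∀ {n} {W X : Walk Y n} → SameLink W X → SameLink (embed W) (embed X)
  embed-cong (inj₁ (p , q)) = inj₁ (cong vertexOf ∘ p , cong edgeOf ∘ q)
  embed-cong (inj₂ (p , q)) = inj₂ (cong vertexOf ∘ p , cong edgeOf ∘ q)

  embed-reflects : ∀ {n} {W X : Walk Y n} → SameLink (embed W) (embed X) → SameLink W X
  embed-reflects (inj₁ (p , q)) = inj₁ (fV-inj ∘ p , fE-inj ∘ q)
  embed-reflects (inj₂ (p , q)) = inj₂ (fV-inj ∘ p , fE-inj ∘ q)

  InImage : ∀ {n} → Walk G n → Set
  InImage {n} X = Σ (Walk Y n) λ W → SameLink (embed W) X

  image-vertex-in-S : ∀ {n} {X : Walk G n} → InImage X → ∀ i → inV S (vs X i)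
  image-vertex-in-S (W , inj₁ (p , q)) i = subst (inV S) (p i) (proj₂ (fV (vs W i)))
  image-vertex-in-S {X = X} (W , inj₂ (p , q)) i =
    subst (inV S) (trans (p (opposite i)) (cong (vs X) (opposite-involutive i))) (proj₂ (fV (vs W (opposite i))))

  image-edge-in-S : ∀ {n} {X : Walk G n} → InImage X → ∀ i → inE S (es X i)
  image-edge-in-S (W , inj₁ (p , q)) i = subst (inE S) (q i) (proj₂ (fE (es W i)))
  image-edge-in-S {X = X} (W , inj₂ (p , q)) i =
    subst (inE S) (trans (q (opposite i)) (cong (es X) (opposite-involutive i))) (proj₂ (fE (es W (opposite i))))

  -- the image of 𝕃ℓ(Y) in 𝕃ℓ(G); it is closed since ends of transported links are transported
  image : (ℓ : ℕ) → Sub (𝕃 ℓ G)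
  image ℓ = record
    { inV = InImage
    ; inE = InImage
    ; respV = λ {X} {Z} X≈Z (W , same) → W , Setoid.trans (linkSetoid G ℓ) {embed W} {X} {Z} same X≈Z
    ; respE = λ {X} {Z} X≈Z (W , same) → W , Setoid.trans (linkSetoid G (suc ℓ)) {embed W} {X} {Z} same X≈Z
    ; closed = ends-in-image
    }
    where
    ends-in-image : (X : Walk G (suc ℓ)) → InImage X → InImage (initW X) × InImage (tailW X)
    ends-in-image X (W , same) with SameLink-ends {W = embed W} {X} same
    ... | inj₁ (init≈ , tail≈) = (initW W , init≈) , (tailW W , tail≈)
    ... | inj₂ (init≈ , tail≈) = (tailW W , tail≈) , (initW W , init≈)

  image-iso : (ℓ : ℕ) → 𝕃 ℓ Y ≅ SubG (image ℓ)
  image-iso ℓ = record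
    { fV = λ W → embed W , W , Setoid.refl (linkSetoid G ℓ) {embed W}
    ; fE = λ W → embed W , W , Setoid.refl (linkSetoid G (suc ℓ)) {embed W}
    ; fV-cong = λ {W} {X} → embed-cong {W = W} {X}
    ; fE-cong = λ {W} {X} → embed-cong {W = W} {X}
    ; fV-inj = λ {W} {X} → embed-reflects {W = W} {X}
    ; fE-inj = λ {W} {X} → embed-reflects {W = W} {X}
    ; fV-surj = proj₂
    ; fE-surj = proj₂
    ; incid = λ W → inj₁ (Setoid.refl (linkSetoid G ℓ) {initW (embed W)} , Setoid.refl (linkSetoid G ℓ) {tailW (embed W)})
    }

  -- if every unit of G is ℓ-incident, a unit missing from S removes an ℓ-link
  -- (or, for an edge and ℓ = 0, the 1-link of that edge) from the image
  image-proper : ∀ ℓ → IsWhole (G [ ℓ ]) → Proper S → Proper (image ℓ)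
  image-proper ℓ (allV , _) (inj₁ (v , v∉S)) with allV v
  ... | W , incident with vertex-occurs {W = W} incident
  ... | i , vi≡v = inj₁ (W , λ inImage → v∉S (subst (inV S) vi≡v (image-vertex-in-S {X = W} inImage i)))
  image-proper zero _ (inj₂ (e , e∉S)) =
    inj₂ (edgeLink e , λ inImage → e∉S (image-edge-in-S {X = edgeLink e} inImage zero))
  image-proper (suc ℓ) (_ , allE) (inj₂ (e , e∉S)) with allE e
  ... | W , incident with edge-occurs {W = W} incident
  ... | i , ei≡e = inj₁ (W , λ inImage → e∉S (subst (inE S) ei≡e (image-edge-in-S {X = W} inImage i)))

whole⇒minimal : ∀ ℓ G → IsWhole (G [ ℓ ]) → Minimal ℓ G
whole⇒minimal ℓ G whole = inj₂ λ Y _ (S , S-proper , φ) →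
  let open Embedding {S = S} φ in image ℓ , image-proper ℓ whole S-proper , image-iso ℓ

module Selection (G : Graph) (keepV : V G → Bool) (keepE : E G → Bool) where
  KeptV : V G → Set
  KeptV v = T (keepV v)

  KeptE : E G → Set
  KeptE e = T (keepE e) × KeptV (end₁ G e) × KeptV (end₂ G e)

  selected : Sub (toS G)
  selected = record
    { inV = KeptV
    ; inE = KeptE
    ; respV = λ { refl kept → kept }
    ; respE = λ { refl kept → kept }
    ; closed = λ _ kept → proj₂ kept
    }

  graph : Graph
  graph = record
    { V = Σ (V G) KeptV
    ; E = Σ (E G) KeptE
    ; end₁ = λ (e , _ , kept₁ , _) → end₁ G e , kept₁
    ; end₂ = λ (e , _ , _ , kept₂) → end₂ G e , kept₂
    }

  -- selection proofs are irrelevant, so units of the graph are determined by G's units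
  vertex-ext : (x y : V graph) → proj₁ x ≡ proj₁ y → x ≡ y
  vertex-ext (v , p) (.v , q) refl = cong (v ,_) (T-irrelevant p q)

  edge-ext : (x y : E graph) → proj₁ x ≡ proj₁ y → x ≡ y
  edge-ext (e , p , p₁ , p₂) (.e , q , q₁ , q₂) refl
    rewrite T-irrelevant p q | T-irrelevant p₁ q₁ | T-irrelevant p₂ q₂ = refl

  graph-loopless : Loopless G → Loopless graph
  graph-loopless loopless e ends≡ = loopless (proj₁ e) (cong proj₁ ends≡)

  graph-iso : toS graph ≅ SubG selected
  graph-iso = record
    { fV = λ x → x ; fE = λ x → x
    ; fV-cong = cong proj₁ ; fE-cong = cong proj₁
    ; fV-inj = vertex-ext _ _ ; fE-inj = edge-ext _ _
    ; fV-surj = λ y → y , refl ; fE-surj = λ y → y , refl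
    ; incid = λ _ → inj₁ (refl , refl)
    }

  lift : ∀ {n} (W : Walk G n) → (∀ i → KeptV (vs W i)) → (∀ i → T (keepE (es W i))) → Walk graph n
  lift {n} W keptV keptE = record
    { vs = λ i → vs W i , keptV i
    ; es = λ i → es W i , keptE i , ends-kept (joins W i)
    ; joins = λ i → lift-joins (joins W i)
    ; nobt = λ i j next same → nobt W i j next (cong proj₁ same)
    }
    where
    ends-kept : ∀ {i} → Joins G (es W i) (vs W (inject₁ i)) (vs W (suc i)) →
                KeptV (end₁ G (es W i)) × KeptV (end₂ G (es W i))
    ends-kept {i} (inj₁ (a , b)) = subst KeptV (sym a) (keptV (inject₁ i)) , subst KeptV (sym b) (keptV (suc i))
    ends-kept {i} (inj₂ (a , b)) = subst KeptV (sym a) (keptV (suc i)) , subst KeptV (sym b) (keptV (inject₁ i))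
    lift-joins : ∀ {i} (J : Joins G (es W i) (vs W (inject₁ i)) (vs W (suc i))) →
                 Joins graph (es W i , keptE i , ends-kept J) (vs W (inject₁ i) , keptV (inject₁ i)) (vs W (suc i) , keptV (suc i))
    lift-joins (inj₁ (a , b)) = inj₁ (vertex-ext _ _ a , vertex-ext _ _ b)
    lift-joins (inj₂ (a , b)) = inj₂ (vertex-ext _ _ a , vertex-ext _ _ b)


no-proper-copy : ExcludedMiddle 0ℓ → ∀ ℓ {G Y : Graph} → Finite ℓ G →
  (liftV : Walk G ℓ → Walk Y ℓ) → (∀ {W X} → SameLink (liftV W) (liftV X) → SameLink W X) →
  (liftE : Walk G (suc ℓ) → Walk Y (suc ℓ)) → (∀ {W X} → SameLink (liftE W) (liftE X) → SameLink W X) →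
  (T : Sub (𝕃 ℓ G)) → Proper T → ¬ (𝕃 ℓ Y ≅ SubG T)
no-proper-copy em ℓ {G} (finV , _) liftV liftV-reflects _ _ T (inj₁ (w , w∉T)) ψ =
  no-injection-into-proper-part finV (inV T) (respV T) w w∉T (proj₁ ∘ fV ∘ liftV)
    (liftV-reflects ∘ fV-inj) (proj₂ ∘ fV ∘ liftV)
  where
  open FiniteSetoid em (linkSetoid G ℓ)
  open _≅_ ψ
no-proper-copy em ℓ {G} (_ , finE) _ _ liftE liftE-reflects T (inj₂ (w , w∉T)) ψ =
  no-injection-into-proper-part finE (inE T) (respE T) w w∉T (proj₁ ∘ fE ∘ liftE)
    (liftE-reflects ∘ fE-inj) (proj₂ ∘ fE ∘ liftE)
  where
  open FiniteSetoid em (linkSetoid G (suc ℓ))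
  open _≅_ ψ

module _ (em : ExcludedMiddle 0ℓ) (ℓ : ℕ) (G : Graph) where
  -- G[ℓ], with membership decided classically
  open Selection G (λ v → isYes (em {VIncident ℓ G v})) (λ e → isYes (em {EIncident ℓ G e}))

  liftℓ : Walk G ℓ → Walk graph ℓ
  liftℓ W = lift W (λ i → fromWitness (W , vertex-incident W i)) (λ i → fromWitness (W , edge-incident W i))

  liftℓ+1 : Walk G (suc ℓ) → Walk graph (suc ℓ)
  liftℓ+1 W = lift W (fromWitness ∘ vertex-of-longer-link ℓ W) (fromWitness ∘ edge-of-longer-link ℓ W)

  -- lifting is undone by the embedding of G[ℓ] into G, so it reflects equality of links
  liftℓ-reflects : ∀ {W X} → SameLink (liftℓ W) (liftℓ X) → SameLink W X
  liftℓ-reflects {W} {X} = Embedding.embed-cong {S = selected} graph-iso {W = liftℓ W} {liftℓ X}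

  liftℓ+1-reflects : ∀ {W X} → SameLink (liftℓ+1 W) (liftℓ+1 X) → SameLink W X
  liftℓ+1-reflects {W} {X} = Embedding.embed-cong {S = selected} graph-iso {W = liftℓ+1 W} {liftℓ+1 X}

  minimal⇒not-proper : Loopless G → Finite ℓ G → Minimal ℓ G → ¬ Proper selected
  minimal⇒not-proper _ _ (inj₁ null) (inj₁ (v , _)) = null v
  minimal⇒not-proper _ _ (inj₁ null) (inj₂ (e , _)) = null (end₁ G e)
  minimal⇒not-proper loopless finite (inj₂ minimal) proper
    with minimal graph (graph-loopless loopless) (selected , proper , graph-iso)
  ... | T , T-proper , ψ = no-proper-copy em ℓ finite liftℓ liftℓ-reflects liftℓ+1 liftℓ+1-reflects T T-proper ψ

  minimal⇒whole : Loopless G → Finite ℓ G → Minimal ℓ G → IsWhole (G [ ℓ ])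
  minimal⇒whole loopless finite minimal =
    (λ v → decidable-stable em λ v∉G[ℓ] → not-proper (inj₁ (v , v∉G[ℓ] ∘ toWitness))) ,
    (λ e → decidable-stable em λ e∉G[ℓ] → not-proper (inj₂ (e , e∉G[ℓ] ∘ toWitness ∘ proj₁)))
    where
    not-proper : ¬ Proper selected
    not-proper = minimal⇒not-proper loopless finite minimal

lemma4p9 : ExcludedMiddle 0ℓ →
    ∀ (ℓ : ℕ) (G : Graph) → Loopless G → Finite ℓ G →
      (Minimal ℓ G → IsWhole (G [ ℓ ])) × (IsWhole (G [ ℓ ]) → Minimal ℓ G)
lemma4p9 em ℓ G loopless finite = minimal⇒whole em ℓ G loopless finite , whole⇒minimal ℓ G
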